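{- For every integer $n\geq 1$, the number $L_n$ of large $(3,2)$-Motzkin paths of length $n$ equals $2m_{n-1}$, where $m_{n-1}$ is the number of $(3,2)$-Motzkin paths of length $n-1$.
   Context: A $(3,2)$-Motzkin path of length $n$ is a lattice path from $(0,0)$ to $(n,0)$ never going below the $x$-axis, consisting of up steps $u=(1,1)$, level steps $(1,0)$ and down steps $(1,-1)$, where each down step receives one of two colors $d_1,d_2$ and each level step receives one of three colors $l_1,l_2,l_3$. A large $(3,2)$-Motzkin path is a $(3,2)$-Motzkin path in which every level step lying on the $x$-axis has color $l_1$ or $l_2$. -}

module Defs where

open import Data.Nat using (ℕ; zero; suc; _+_; _*_)
open import Data.Bool using (Bool; true; false; _∧_)
open import Data.List using (List; []; _∷_; map; concatMap; length; filter)
open import Data.Fin using (Fin)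
open import Relation.Binary.PropositionalEquality using (_≡_)
open import Relation.Nullary using (Dec)
open import Data.Bool using (_≟_)

-- Steps of a (3,2)-Motzkin path:
--   up       : u = (1,1)
--   level i  : level step (1,0) with colour l_{i+1}, i ∈ Fin 3
--   down j   : down step (1,-1) with colour d_{j+1}, j ∈ Fin 2
data Step : Set where
  up    : Step
  level : Fin 3 → Step
  down  : Fin 2 → Step

allSteps : List Step
allSteps = up ∷ level Fin.zero ∷ level (Fin.suc Fin.zero) ∷ level (Fin.suc (Fin.suc Fin.zero))
         ∷ down Fin.zero ∷ down (Fin.suc Fin.zero) ∷ []

words : ℕ → List (List Step)
words zero    = [] ∷ []
words (suc n) = concatMap (λ s → map (s ∷_) (words n)) allSteps

validFrom : ℕ → List Step → Bool
validFrom zero    []             = true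
validFrom (suc _) []             = false
validFrom h       (up ∷ w)       = validFrom (suc h) w
validFrom h       (level _ ∷ w)  = validFrom h w
validFrom zero    (down _ ∷ w)   = false
validFrom (suc h) (down _ ∷ w)   = validFrom h w

largeFrom : ℕ → List Step → Bool
largeFrom zero    []             = true
largeFrom (suc _) []             = false
largeFrom h       (up ∷ w)       = largeFrom (suc h) w
largeFrom zero    (level (Fin.suc (Fin.suc Fin.zero)) ∷ w) = false
largeFrom h       (level _ ∷ w)  = largeFrom h w
largeFrom zero    (down _ ∷ w)   = false
largeFrom (suc h) (down _ ∷ w)   = largeFrom h w

IsMotzkin : List Step → Set
IsMotzkin w = validFrom 0 w ≡ true

IsLargeMotzkin : List Step → Set
IsLargeMotzkin w = largeFrom 0 w ≡ true

m : ℕ → ℕ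
m n = length (filter (λ w → validFrom 0 w ≟ true) (words n))

L : ℕ → ℕ
L n = length (filter (λ w → largeFrom 0 w ≟ true) (words n))

-- A large path from height h of length n + 1 is counted by twice the number of
-- Motzkin paths of length n starting at h or at h − 1 (the latter absent on the
-- ground).  Both sides obey the same first-step recurrence away from the ground, and
-- on the ground the loss of colour l₃ is exactly compensated, so the identity follows
-- by induction on n for all heights at once; at height 0 it is the theorem.
module Submission where

open import Defs
open import Data.Nat using (ℕ; zero; suc; _+_; _*_)
open import Data.Nat.Properties using (+-identityʳ)
open import Data.Nat.Tactic.RingSolver using (solve-∀)
open import Data.Bool using (Bool; true; false; _≟_)
open import Data.List using (List; []; _∷_; _++_; map; concatMap; filter; length)
open import Data.Nat.ListAction using (sum)
open import Data.List.Properties using (filter-++; length-++; map-cong)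
open import Function using (_∘_)
open import Relation.Binary.PropositionalEquality using (_≡_; refl; sym; cong; cong₂; trans)
open Relation.Binary.PropositionalEquality.≡-Reasoning

count : (List Step → Bool) → List (List Step) → ℕ
count p ws = length (filter (λ w → p w ≟ true) ws)

count-++ : ∀ p xs ys → count p (xs ++ ys) ≡ count p xs + count p ys
count-++ p xs ys = trans (cong length (filter-++ _ xs ys)) (length-++ (filter _ xs))

count-concatMap : ∀ {A : Set} p (f : A → List (List Step)) xs →
                  count p (concatMap f xs) ≡ sum (map (count p ∘ f) xs)
count-concatMap p f []       = refl
count-concatMap p f (x ∷ xs) =
  trans (count-++ p (f x) _) (cong (count p (f x) +_) (count-concatMap p f xs))

count-map-∷ : ∀ p s ws → count p (map (s ∷_) ws) ≡ count (p ∘ (s ∷_)) ws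
count-map-∷ p s []       = refl
count-map-∷ p s (w ∷ ws) with p (s ∷ w)
... | true  = cong suc (count-map-∷ p s ws)
... | false = count-map-∷ p s ws

count-false : ∀ ws → count (λ _ → false) ws ≡ 0
count-false []       = refl
count-false (_ ∷ ws) = count-false ws

count-words-suc : ∀ p n →
  count p (words (suc n)) ≡ sum (map (λ s → count (p ∘ (s ∷_)) (words n)) allSteps)
count-words-suc p n = trans (count-concatMap p (λ s → map (s ∷_) (words n)) allSteps)
  (cong sum (map-cong (λ s → count-map-∷ p s (words n)) allSteps))

first-step-sum : ∀ a b c → a + (b + (b + (b + (c + (c + 0))))) ≡ a + 3 * b + 2 * c
first-step-sum = solve-∀

#motzkin : ℕ → ℕ → ℕ
#motzkin h n = count (validFrom h) (words n)

#large : ℕ → ℕ → ℕ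
#large h n = count (largeFrom h) (words n)

#motzkin↓ : ℕ → ℕ → ℕ
#motzkin↓ zero    n = 0
#motzkin↓ (suc h) n = #motzkin h n

#motzkin-suc : ∀ h n →
  #motzkin h (suc n) ≡ #motzkin (suc h) n + 3 * #motzkin h n + 2 * #motzkin↓ h n
#motzkin-suc zero n = begin
  #motzkin 0 (suc n)
    ≡⟨ count-words-suc (validFrom 0) n ⟩
  _ ≡⟨ first-step-sum (#motzkin 1 n) (#motzkin 0 n) (count (λ _ → false) (words n)) ⟩
  _ ≡⟨ cong (λ x → #motzkin 1 n + 3 * #motzkin 0 n + 2 * x) (count-false (words n)) ⟩
  #motzkin 1 n + 3 * #motzkin 0 n + 2 * 0 ∎
#motzkin-suc (suc h) n = trans (count-words-suc (validFrom (suc h)) n)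
  (first-step-sum (#motzkin (suc (suc h)) n) (#motzkin (suc h) n) (#motzkin h n))

#large-suc-ground : ∀ n → #large 0 (suc n) ≡ #large 1 n + 2 * #large 0 n
#large-suc-ground n = begin
  #large 0 (suc n)
    ≡⟨ count-words-suc (largeFrom 0) n ⟩
  a + (b + (b + (f + (f + (f + 0)))))
    ≡⟨ cong (λ x → a + (b + (b + (x + (x + (x + 0)))))) (count-false (words n)) ⟩
  a + (b + (b + (0 + (0 + (0 + 0)))))
    ≡⟨ arith a b ⟩
  a + 2 * b ∎
  where
    arith : ∀ a b → a + (b + (b + (0 + (0 + (0 + 0))))) ≡ a + 2 * b
    arith = solve-∀
    a = #large 1 n
    b = #large 0 n
    f = count (λ _ → false) (words n)

#large-suc-raised : ∀ h n →
  #large (suc h) (suc n) ≡ #large (suc (suc h)) n + 3 * #large (suc h) n + 2 * #large h n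
#large-suc-raised h n = trans (count-words-suc (largeFrom (suc h)) n)
  (first-step-sum (#large (suc (suc h)) n) (#large (suc h) n) (#large h n))

#large-suc : ∀ n h → #large h (suc n) ≡ 2 * (#motzkin h n + #motzkin↓ h n)
#large-suc zero zero          = refl
#large-suc zero (suc zero)    = refl
#large-suc zero (suc (suc h)) = refl
#large-suc (suc n) zero = begin
  #large 0 (suc (suc n))
    ≡⟨ #large-suc-ground (suc n) ⟩
  #large 1 (suc n) + 2 * #large 0 (suc n)
    ≡⟨ cong₂ (λ x y → x + 2 * y) (#large-suc n 1) (#large-suc n 0) ⟩
  2 * (a + b) + 2 * (2 * (b + 0))
    ≡⟨ arith a b ⟩
  2 * ((a + 3 * b + 2 * 0) + 0)
    ≡⟨ cong (λ x → 2 * (x + 0)) (sym (#motzkin-suc 0 n)) ⟩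
  2 * (#motzkin 0 (suc n) + 0) ∎
  where
    arith : ∀ a b → 2 * (a + b) + 2 * (2 * (b + 0)) ≡ 2 * ((a + 3 * b + 2 * 0) + 0)
    arith = solve-∀
    a = #motzkin 1 n
    b = #motzkin 0 n
#large-suc (suc n) (suc h) = begin
  #large (suc h) (suc (suc n))
    ≡⟨ #large-suc-raised h (suc n) ⟩
  #large (suc (suc h)) (suc n) + 3 * #large (suc h) (suc n) + 2 * #large h (suc n)
    ≡⟨ cong₂ _+_ (cong₂ (λ x y → x + 3 * y) (#large-suc n (suc (suc h))) (#large-suc n (suc h)))
                 (cong (2 *_) (#large-suc n h)) ⟩
  2 * (a + b) + 3 * (2 * (b + c)) + 2 * (2 * (c + d))
    ≡⟨ arith a b c d ⟩
  2 * ((a + 3 * b + 2 * c) + (b + 3 * c + 2 * d))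
    ≡⟨ cong₂ (λ x y → 2 * (x + y)) (sym (#motzkin-suc (suc h) n)) (sym (#motzkin-suc h n)) ⟩
  2 * (#motzkin (suc h) (suc n) + #motzkin h (suc n)) ∎
  where
    arith : ∀ a b c d → 2 * (a + b) + 3 * (2 * (b + c)) + 2 * (2 * (c + d))
                      ≡ 2 * ((a + 3 * b + 2 * c) + (b + 3 * c + 2 * d))
    arith = solve-∀
    a = #motzkin (suc (suc h)) n
    b = #motzkin (suc h) n
    c = #motzkin h n
    d = #motzkin↓ h n

mainTheorem2 : (n : ℕ) → L (suc n) ≡ 2 * m n
mainTheorem2 n = trans (#large-suc n 0) (cong (2 *_) (+-identityʳ (m n)))
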